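{- Let $P$ be a finite poset and let $I\in\mathcal{IC}(P)$. Then \[ \mathrm{Row}(I) = \Big( \mathrm{Inc}(\lceil I\rceil) - I \Big)\cup\Big(\Delta\lceil I\rceil-\Delta\big(\mathrm{Min}(I)\cap\Delta\lceil I\rceil\big) \Big). \]
   Context: A subset $I$ of a finite poset $P$ is interval-closed if whenever $x,y\in I$, $z\in P$ and $x\le z\le y$, then $z\in I$; $\mathcal{IC}(P)$ denotes the set of interval-closed sets of $P$. For $x\in P$, the toggle $t_x:\mathcal{IC}(P)\to\mathcal{IC}(P)$ sends $I$ to $I\setminus\{x\}$ if $x\in I$ and $I\setminus\{x\}\in\mathcal{IC}(P)$, to $I\cup\{x\}$ if $x\notin I$ and $I\cup\{x\}\in\mathcal{IC}(P)$, and to $I$ otherwise. Rowmotion is $\mathrm{Row}=t_{x_1}\circ t_{x_2}\circ\cdots\circ t_{x_N}$, where $x_1,\dots,x_N$ is any linear extension of $P$ (so toggles are applied in the reverse order of the linear extension, top to bottom); this does not depend on the linear extension chosen. For $S\subseteq P$: $\Delta(S)=\{y\in P: y\le s \text{ for some } s\in S\}$ is the smallest order ideal containing $S$; $\nabla(S)=\{y\in P: y\ge s\text{ for some } s\in S\}$ is the smallest order filter containing $S$; $\mathrm{Min}(S)$ is the set of minimal elements of $S$; $\mathrm{Inc}(S)$ is the set of elements of $P$ incomparable with every element of $S$. The ceiling of $I$ is $\lceil I\rceil=\mathrm{Min}(\nabla(I)-I)$. We write $\Delta\lceil I\rceil$ for $\Delta(\lceil I\rceil)$. -}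

module Defs where

open import Level using (0ℓ)
open import Data.Nat using (ℕ)
open import Data.Fin using (Fin) renaming (_≤_ to _≤ᶠ_)
open import Data.Fin.Properties using (all?)
open import Data.Bool using (Bool; true; false; T; not; _∧_; _∨_; if_then_else_)
open import Data.List using (List; allFin; foldr)
open import Data.Bool.ListAction using (any; all)
open import Relation.Binary using (Rel; IsDecPartialOrder)
open import Relation.Binary.PropositionalEquality using (_≡_)
open import Relation.Nullary using (Dec; does)
open import Relation.Nullary.Decidable using (T?; _→-dec_)
open import Function.Definitions using (Bijective)

-- A finite poset, with ground set Fin n (every finite poset is isomorphic
-- to one of this form).  The order is decidable (automatic for finite sets
-- classically; required here to compute toggles).
record FinPoset : Set₁ where
  field
    n   : ℕ
    _≼_ : Rel (Fin n) 0ℓ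
    isDecPartialOrder : IsDecPartialOrder _≡_ _≼_
  open IsDecPartialOrder isDecPartialOrder public
    using (_≟_) renaming (_≤?_ to _≼?_)

module _ (P : FinPoset) where
  open FinPoset P

  Subset : Set
  Subset = Fin n → Bool

  _∈_ : Fin n → Subset → Set
  x ∈ S = T (S x)

  leq : Fin n → Fin n → Bool
  leq x y = does (x ≼? y)

  eqb : Fin n → Fin n → Bool
  eqb x y = does (x ≟ y)

  elems : List (Fin n)
  elems = allFin n

  _∖_ : Subset → Subset → Subset
  (A ∖ B) x = A x ∧ not (B x)

  _∪_ : Subset → Subset → Subset
  (A ∪ B) x = A x ∨ B x

  _∩_ : Subset → Subset → Subset
  (A ∩ B) x = A x ∧ B x

  Δ : Subset → Subset
  Δ S y = any (λ s → S s ∧ leq y s) elems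

  ∇ : Subset → Subset
  ∇ S y = any (λ s → S s ∧ leq s y) elems

  Min : Subset → Subset
  Min S y = S y ∧ all (λ z → not (S z ∧ leq z y ∧ not (eqb z y))) elems

  Inc : Subset → Subset
  Inc S y = all (λ s → not (S s ∧ (leq y s ∨ leq s y))) elems

  ⌈_⌉ : Subset → Subset
  ⌈ I ⌉ = Min (∇ I ∖ I)

  IntervalClosed : Subset → Set
  IntervalClosed I = ∀ x y z → x ∈ I → y ∈ I → x ≼ z → z ≼ y → z ∈ I

  intervalClosed? : (I : Subset) → Dec (IntervalClosed I)
  intervalClosed? I =
    all? λ x → all? λ y → all? λ z →
      T? (I x) →-dec T? (I y) →-dec (x ≼? z) →-dec (z ≼? y) →-dec T? (I z)

  remove : Fin n → Subset → Subset
  remove x I y = I y ∧ not (eqb y x)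

  insert : Fin n → Subset → Subset
  insert x I y = I y ∨ eqb y x

  toggle : Fin n → Subset → Subset
  toggle x I =
    if I x
    then (if does (intervalClosed? (remove x I)) then remove x I else I)
    else (if does (intervalClosed? (insert x I)) then insert x I else I)

  -- a linear extension x_1,…,x_N of P, given as a bijection
  -- L : Fin n → Fin n (L i is the (i+1)-st element) such that
  -- L i ≼ L j implies i ≤ j
  record LinearExtension : Set where
    field
      L         : Fin n → Fin n
      bijective : Bijective _≡_ _≡_ L
      monotone  : ∀ i j → L i ≼ L j → i ≤ᶠ j

  -- Row = t_{x_1} ∘ t_{x_2} ∘ ⋯ ∘ t_{x_N}  (t_{x_N} applied first)
  Row : LinearExtension → Subset → Subset
  Row ext I = foldr (λ i J → toggle (LinearExtension.L ext i) J) I elems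

{-# OPTIONS --safe #-}
module Submission where

-- Write R for the right-hand side. Toggling down a linear extension, once the elements of an
-- up-set U have been toggled the current set is R on U and I off U. Such a piecewise set is
-- interval-closed, and when the next element x has x ∈ I ⇔ x ∈ R, flipping x would break
-- interval-closedness, so the toggle leaves x alone. Removing x fails because x is not minimal
-- in I (else it would lie in Δ(Min I ∩ Δ⌈I⌉)), so it sits strictly between an element of I and
-- an element of ⌈I⌉. Adding x fails because either x lies below some m ∈ Min I ∩ Δ⌈I⌉, which
-- closing the interval from x up to ⌈I⌉ would force into R, or x lies above some c ∈ ⌈I⌉,
-- which closing the interval from I up to x would force into I.

open import Defs hiding (_∈_)
open import Level using (0ℓ)
open import Data.Bool using (Bool; true; false; T; not; _∧_; _∨_; if_then_else_)
open import Data.Bool.ListAction using (any; all)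
open import Data.Bool.Properties using (T-∧; T-∨; ∧-zeroʳ; ∧-identityʳ; ∨-zeroʳ; ∨-identityʳ)
open import Data.Empty using (⊥-elim)
open import Data.Fin using (Fin)
open import Data.Fin.Induction using (po-wellFounded)
open import Data.Fin.Properties using (¬∀⟶∃¬)
open import Data.List using (List; []; _∷_; map; foldr; allFin)
open import Data.List.Membership.Propositional using (_∈_; lose)
open import Data.List.Membership.Propositional.Properties using (∈-allFin; ∈-map⁺)
open import Data.List.Properties using (foldr-map)
open import Data.List.Relation.Unary.All as All using (All)
open import Data.List.Relation.Unary.All.Properties using (all⁺; all⁻)
open import Data.List.Relation.Unary.AllPairs using (AllPairs; []; _∷_)
open import Data.List.Relation.Unary.AllPairs.Properties
  using (tabulate⁺-<) renaming (map⁺ to AllPairs-map⁺)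
open import Data.List.Relation.Unary.Any using (here; there; satisfied)
open import Data.List.Relation.Unary.Any.Properties using (any⁺; any⁻)
open import Data.Nat.Properties using (<⇒≱)
open import Data.Product using (∃; _×_; _,_; proj₁; proj₂)
open import Data.Sum as Sum using (_⊎_; inj₁; inj₂)
open import Function using (_∘_; _⇔_; mk⇔)
open import Function.Bundles using (module Equivalence)
open import Induction.WellFounded using (Acc; acc)
open import Relation.Binary using (Rel; IsDecPartialOrder)
open import Relation.Binary.PropositionalEquality
  using (_≡_; _≢_; _≗_; refl; sym; trans; cong; cong-app; subst; module ≡-Reasoning)
open import Relation.Nullary using (¬_; Dec; yes; no; does)
open import Relation.Nullary.Decidable using (T?; decidable-stable; dec-true; dec-false; does-⇔)

open Equivalence using (to; from)

T-not : ∀ {b} → T (not b) ⇔ (¬ T b)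
T-not {true}  = mk⇔ (λ ()) (λ ¬t → ¬t _)
T-not {false} = mk⇔ (λ _ ()) (λ _ → _)

T-any-allFin : ∀ {n} (p : Fin n → Bool) → T (any p (allFin n)) ⇔ ∃ λ x → T (p x)
T-any-allFin p = mk⇔ (satisfied ∘ any⁻ p (allFin _)) (λ (x , px) → any⁺ p (lose (∈-allFin x) px))

T-all-allFin : ∀ {n} (p : Fin n → Bool) → T (all p (allFin n)) ⇔ (∀ x → T (p x))
T-all-allFin p =
  mk⇔ (λ h x → All.lookup (all⁺ p (allFin _) h) (∈-allFin x))
      (λ h → all⁻ p {allFin _} (All.tabulate (λ {x} _ → h x)))

module _ (P : FinPoset) where
  open FinPoset P
  open IsDecPartialOrder isDecPartialOrder using (isPartialOrder)
    renaming (refl to ≼-refl; trans to ≼-trans; antisym to ≼-antisym)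
  open import Data.List.Membership.DecPropositional _≟_ using (_∈?_)

  _≺_ : Rel (Fin n) 0ℓ
  x ≺ y = x ≼ y × x ≢ y

  Comparable : Rel (Fin n) 0ℓ
  Comparable x y = x ≼ y ⊎ y ≼ x

  T-leq : ∀ {x y} → T (leq P x y) ⇔ x ≼ y
  T-leq {x} {y} with x ≼? y
  ... | yes x≼y = mk⇔ (λ _ → x≼y) _
  ... | no x⋠y = mk⇔ (λ ()) x⋠y

  T-not-eqb : ∀ {x y} → T (not (eqb P x y)) ⇔ x ≢ y
  T-not-eqb {x} {y} with x ≟ y
  ... | yes x≡y = mk⇔ (λ ()) (λ x≢y → x≢y x≡y)
  ... | no x≢y = mk⇔ (λ _ → x≢y) _

  Δ⁺ : ∀ {S s y} → T (S s) → y ≼ s → T (Δ P S y)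
  Δ⁺ {s = s} Ss y≼s = from (T-any-allFin _) (s , from T-∧ (Ss , from T-leq y≼s))

  Δ⁻ : ∀ {S y} → T (Δ P S y) → ∃ λ s → T (S s) × y ≼ s
  Δ⁻ h = let (s , Ss∧y≼s) = to (T-any-allFin _) h
             (Ss , y≼s) = to T-∧ Ss∧y≼s
         in s , Ss , to T-leq y≼s

  Δ-downward : ∀ {S y z} → y ≼ z → T (Δ P S z) → T (Δ P S y)
  Δ-downward y≼z h = let (s , Ss , z≼s) = Δ⁻ h in Δ⁺ Ss (≼-trans y≼z z≼s)

  ∇⁺ : ∀ {S s y} → T (S s) → s ≼ y → T (∇ P S y)
  ∇⁺ {s = s} Ss s≼y = from (T-any-allFin _) (s , from T-∧ (Ss , from T-leq s≼y))

  ∇⁻ : ∀ {S y} → T (∇ P S y) → ∃ λ s → T (S s) × s ≼ y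
  ∇⁻ h = let (s , Ss∧s≼y) = to (T-any-allFin _) h
             (Ss , s≼y) = to T-∧ Ss∧s≼y
         in s , Ss , to T-leq s≼y

  Min⁻ : ∀ S {y} → T (Min P S y) → T (S y) × (∀ {z} → T (S z) → z ≼ y → z ≡ y)
  Min⁻ S {y} h =
    let (Sy , nothing-below) = to T-∧ h
    in Sy , λ {z} Sz z≼y → decidable-stable (z ≟ y) λ z≢y →
         to T-not (to (T-all-allFin _) nothing-below z)
           (from T-∧ (Sz , from T-∧ (from T-leq z≼y , from T-not-eqb z≢y)))

  ¬Min⁻ : ∀ S {y} → T (S y) → ¬ T (Min P S y) → ∃ λ z → T (S z) × z ≺ y
  ¬Min⁻ S Sy ¬min =
    let (z , ¬not-below) = ¬∀⟶∃¬ n _ (λ _ → T? _)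
                             (λ nothing-below → ¬min (from T-∧ (Sy , from (T-all-allFin _) nothing-below)))
        (Sz , z≼y∧z≢y) = to T-∧ (decidable-stable (T? _) (¬not-below ∘ from T-not))
        (z≼y , z≢y) = to T-∧ z≼y∧z≢y
    in z , Sz , to T-leq z≼y , to T-not-eqb z≢y

  T-comparable : ∀ {x y} → T (leq P x y ∨ leq P y x) ⇔ Comparable x y
  T-comparable =
    mk⇔ (Sum.map (to T-leq) (to T-leq) ∘ to T-∨) (from T-∨ ∘ Sum.map (from T-leq) (from T-leq))

  Inc⁻ : ∀ {S y s} → T (Inc P S y) → T (S s) → ¬ Comparable y s
  Inc⁻ {s = s} h Ss comparable =
    to T-not (to (T-all-allFin _) h s) (from T-∧ (Ss , from T-comparable comparable))

  ¬Inc⁻ : ∀ S {y} → ¬ T (Inc P S y) → ∃ λ s → T (S s) × Comparable y s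
  ¬Inc⁻ S ¬inc =
    let (s , ¬incomparable) = ¬∀⟶∃¬ n _ (λ _ → T? _) (¬inc ∘ from (T-all-allFin _))
        (Ss , comparable) = to T-∧ (decidable-stable (T? _) (¬incomparable ∘ from T-not))
    in s , Ss , to T-comparable comparable

  minimal-below : ∀ S {b} → T (S b) → ∃ λ c → T (Min P S c) × c ≼ b
  minimal-below S {b} = go (po-wellFounded isPartialOrder b)
    where
      go : ∀ {b} → Acc _≺_ b → T (S b) → ∃ λ c → T (Min P S c) × c ≼ b
      go {b} (acc smaller) Sb with T? (Min P S b)
      ... | yes min-b = b , min-b , ≼-refl
      ... | no ¬min-b =
        let (z , Sz , z≺b) = ¬Min⁻ S Sb ¬min-b
            (c , min-c , c≼z) = go (smaller z≺b) Sz
        in c , min-c , ≼-trans c≼z (proj₁ z≺b)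

  IntervalClosed-resp-≗ : ∀ {A B} → A ≗ B → IntervalClosed P A → IntervalClosed P B
  IntervalClosed-resp-≗ A≗B A-ic a b z Ba Bb a≼z z≼b =
    subst T (A≗B z) (A-ic a b z (subst T (sym (A≗B a)) Ba) (subst T (sym (A≗B b)) Bb) a≼z z≼b)

  ≗-from-at-and-off : ∀ {x} {A B : Subset P} → A x ≡ B x → (∀ {y} → y ≢ x → A y ≡ B y) → A ≗ B
  ≗-from-at-and-off {x} at off y with y ≟ x
  ... | yes refl = at
  ... | no y≢x = off y≢x

  remove-≡ : ∀ x (K : Subset P) → remove P x K x ≡ false
  remove-≡ x K rewrite dec-true (x ≟ x) refl = ∧-zeroʳ (K x)

  remove-≢ : ∀ {x y} (K : Subset P) → y ≢ x → remove P x K y ≡ K y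
  remove-≢ {x} {y} K y≢x rewrite dec-false (y ≟ x) y≢x = ∧-identityʳ (K y)

  insert-≡ : ∀ x (K : Subset P) → insert P x K x ≡ true
  insert-≡ x K rewrite dec-true (x ≟ x) refl = ∨-zeroʳ (K x)

  insert-≢ : ∀ {x y} (K : Subset P) → y ≢ x → insert P x K y ≡ K y
  insert-≢ {x} {y} K y≢x rewrite dec-false (y ≟ x) y≢x = ∨-identityʳ (K y)

  remove-cong : ∀ {x} {J K : Subset P} → J ≗ K → remove P x J ≗ remove P x K
  remove-cong {x} J≗K y = cong (_∧ not (eqb P y x)) (J≗K y)

  insert-cong : ∀ {x} {J K : Subset P} → J ≗ K → insert P x J ≗ insert P x K
  insert-cong {x} J≗K y = cong (_∨ eqb P y x) (J≗K y)

  removing-interior-point : ∀ {K a x b} → T (K a) → T (K b) → a ≺ x → x ≺ b →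
                            ¬ IntervalClosed P (remove P x K)
  removing-interior-point {K} {a} {x} {b} Ka Kb (a≼x , a≢x) (x≼b , x≢b) ic =
    subst T (remove-≡ x K)
      (ic a b x (subst T (sym (remove-≢ K a≢x)) Ka) (subst T (sym (remove-≢ K (x≢b ∘ sym))) Kb)
            a≼x x≼b)

  insert-⊇ : ∀ {x y} (K : Subset P) → T (K y) → T (insert P x K y)
  insert-⊇ K Ky = from T-∨ (inj₁ Ky)

  insert-∋ : ∀ x (K : Subset P) → T (insert P x K x)
  insert-∋ x K = subst T (sym (insert-≡ x K)) _

  insert-ic-below : ∀ {K a z x} → IntervalClosed P (insert P x K) → T (K a) → a ≼ z → z ≺ x → T (K z)
  insert-ic-below {K} {a} {z} {x} ic Ka a≼z (z≼x , z≢x) =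
    subst T (insert-≢ K z≢x) (ic a x z (insert-⊇ K Ka) (insert-∋ x K) a≼z z≼x)

  insert-ic-above : ∀ {K b z x} → IntervalClosed P (insert P x K) → T (K b) → x ≺ z → z ≼ b → T (K z)
  insert-ic-above {K} {b} {z} {x} ic Kb (x≼z , x≢z) z≼b =
    subst T (insert-≢ K (x≢z ∘ sym)) (ic x b z (insert-∋ x K) (insert-⊇ K Kb) x≼z z≼b)

  remove-≗ : ∀ {x} {J K : Subset P} → (∀ {y} → y ≢ x → J y ≡ K y) → K x ≡ false → remove P x J ≗ K
  remove-≗ {x} {J} off Kx =
    ≗-from-at-and-off (trans (remove-≡ x J) (sym Kx)) (λ y≢x → trans (remove-≢ J y≢x) (off y≢x))

  insert-≗ : ∀ {x} {J K : Subset P} → (∀ {y} → y ≢ x → J y ≡ K y) → K x ≡ true → insert P x J ≗ K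
  insert-≗ {x} {J} off Kx =
    ≗-from-at-and-off (trans (insert-≡ x J) (sym Kx)) (λ y≢x → trans (insert-≢ J y≢x) (off y≢x))

  toggle-≗ : ∀ {x} {J K : Subset P} → (∀ {y} → y ≢ x → J y ≡ K y) → IntervalClosed P K →
             (T (J x) → T (K x) → ¬ IntervalClosed P (remove P x J)) →
             (¬ T (J x) → ¬ T (K x) → ¬ IntervalClosed P (insert P x J)) →
             toggle P x J ≗ K
  toggle-≗ {x} {J} {K} off K-ic remove-blocked insert-blocked with J x in Jx | K x in Kx
  ... | true | false
    rewrite dec-true (intervalClosed? P (remove P x J))
                     (IntervalClosed-resp-≗ (sym ∘ remove-≗ off Kx) K-ic)
    = remove-≗ off Kx
  ... | false | true
    rewrite dec-true (intervalClosed? P (insert P x J))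
                     (IntervalClosed-resp-≗ (sym ∘ insert-≗ off Kx) K-ic)
    = insert-≗ off Kx
  ... | true | true
    rewrite dec-false (intervalClosed? P (remove P x J)) (remove-blocked _ _)
    = ≗-from-at-and-off (trans Jx (sym Kx)) off
  ... | false | false
    rewrite dec-false (intervalClosed? P (insert P x J)) (insert-blocked (λ ()) (λ ()))
    = ≗-from-at-and-off (trans Jx (sym Kx)) off

  UpSet : Subset P → Set
  UpSet U = ∀ {y z} → T (U y) → y ≼ z → T (U z)

  piecewise : Subset P → Subset P → Subset P → Subset P
  piecewise U A B y = if U y then A y else B y

  piecewise-in : ∀ U A B {y} → T (U y) → piecewise U A B y ≡ A y
  piecewise-in U A B {y} Uy with U y
  ... | true = refl

  piecewise-out : ∀ U A B {y} → ¬ T (U y) → piecewise U A B y ≡ B y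
  piecewise-out U A B {y} ¬Uy with U y
  ... | true = ⊥-elim (¬Uy _)
  ... | false = refl

  members : List (Fin n) → Subset P
  members xs y = does (y ∈? xs)

  T-members : ∀ xs {y} → T (members xs y) ⇔ y ∈ xs
  T-members xs {y} with y ∈? xs
  ... | yes y∈xs = mk⇔ (λ _ → y∈xs) _
  ... | no y∉xs = mk⇔ (λ ()) y∉xs

  members-∷-≢ : ∀ {x xs y} → y ≢ x → members (x ∷ xs) y ≡ members xs y
  members-∷-≢ {x} {xs} {y} y≢x = does-⇔ (mk⇔ drop-head there) (y ∈? x ∷ xs) (y ∈? xs)
    where
      drop-head : y ∈ x ∷ xs → y ∈ xs
      drop-head (here y≡x) = ⊥-elim (y≢x y≡x)
      drop-head (there y∈xs) = y∈xs

  Upward : List (Fin n) → Set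
  Upward xs = ∀ {y z} → y ∈ xs → y ≼ z → z ∈ xs

  Upward⇒UpSet : ∀ {xs} → Upward xs → UpSet (members xs)
  Upward⇒UpSet {xs} upward Uy y≼z = from (T-members xs) (upward (to (T-members xs) Uy) y≼z)

  module _ {I R : Subset P}
           (piecewise-ic : ∀ {U} → UpSet U → IntervalClosed P (piecewise U R I))
           (remove-blocked : ∀ {U x} → (∀ {y} → y ≼ x → ¬ T (U y)) → (∀ {y} → x ≺ y → T (U y)) →
                             T (I x) → T (R x) → ¬ IntervalClosed P (remove P x (piecewise U R I)))
           (insert-blocked : ∀ {U x} → (∀ {y} → y ≼ x → ¬ T (U y)) → (∀ {y} → x ≺ y → T (U y)) →
                             ¬ T (I x) → ¬ T (R x) → ¬ IntervalClosed P (insert P x (piecewise U R I)))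
           where

    toggles-≗ : ∀ {xs} → AllPairs (λ x y → ¬ y ≼ x) xs → Upward xs →
                foldr (toggle P) I xs ≗ piecewise (members xs) R I
    toggles-≗ {[]} [] _ y = refl
    toggles-≗ {x ∷ xs} (nothing-below-x ∷ sorted) upward =
      toggle-≗ off (piecewise-ic (Upward⇒UpSet upward)) removal-blocked insertion-blocked
      where
        below-out : ∀ {y} → y ≼ x → ¬ T (members xs y)
        below-out y≼x y∈xs = All.lookup nothing-below-x (to (T-members xs) y∈xs) y≼x

        above-in : ∀ {y} → x ≺ y → T (members xs y)
        above-in (x≼y , x≢y) with upward (here refl) x≼y
        ... | here y≡x = ⊥-elim (x≢y (sym y≡x))
        ... | there y∈xs = from (T-members xs) y∈xs

        upward-xs : Upward xs
        upward-xs y∈xs y≼z with upward (there y∈xs) y≼z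
        ... | here refl = ⊥-elim (below-out y≼z (from (T-members xs) y∈xs))
        ... | there z∈xs = z∈xs

        J K : Subset P
        J = foldr (toggle P) I xs
        K = piecewise (members (x ∷ xs)) R I

        IH : J ≗ piecewise (members xs) R I
        IH = toggles-≗ sorted upward-xs

        off : ∀ {y} → y ≢ x → J y ≡ K y
        off {y} y≢x =
          trans (IH y) (cong (λ b → if b then R y else I y) (sym (members-∷-≢ {xs = xs} y≢x)))

        Jx≡Ix : J x ≡ I x
        Jx≡Ix = trans (IH x) (piecewise-out (members xs) R I (below-out ≼-refl))

        Kx≡Rx : K x ≡ R x
        Kx≡Rx = piecewise-in (members (x ∷ xs)) R I (from (T-members (x ∷ xs)) (here refl))

        removal-blocked : T (J x) → T (K x) → ¬ IntervalClosed P (remove P x J)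
        removal-blocked Jx Kx =
          remove-blocked below-out above-in (subst T Jx≡Ix Jx) (subst T Kx≡Rx Kx)
          ∘ IntervalClosed-resp-≗ (remove-cong IH)

        insertion-blocked : ¬ T (J x) → ¬ T (K x) → ¬ IntervalClosed P (insert P x J)
        insertion-blocked ¬Jx ¬Kx =
          insert-blocked below-out above-in (¬Jx ∘ subst T (sym Jx≡Ix)) (¬Kx ∘ subst T (sym Kx≡Rx))
          ∘ IntervalClosed-resp-≗ (insert-cong IH)

    Row-≗ : (ext : LinearExtension P) → Row P ext I ≗ R
    Row-≗ ext y = begin
      Row P ext I y                         ≡⟨ cong-app (foldr-map (toggle P) L I (allFin n)) y ⟨
      foldr (toggle P) I Ls y               ≡⟨ toggles-≗ sorted (λ _ _ → listed _) y ⟩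
      piecewise (members Ls) R I y          ≡⟨ piecewise-in (members Ls) R I (from (T-members Ls) (listed y)) ⟩
      R y                                   ∎
      where
        open ≡-Reasoning
        open LinearExtension ext

        Ls : List (Fin n)
        Ls = map L (allFin n)

        listed : ∀ y → y ∈ Ls
        listed y = let (i , Li≡y) = proj₂ bijective y
                   in subst (_∈ Ls) (Li≡y refl) (∈-map⁺ L (∈-allFin i))

        sorted : AllPairs (λ x y → ¬ y ≼ x) Ls
        sorted = AllPairs-map⁺ (tabulate⁺-< λ i<j Lj≼Li → <⇒≱ i<j (monotone _ _ Lj≼Li))

  module _ (I : Subset P) where

    C : Subset P
    C = ⌈_⌉ P I

    D : Subset P
    D = Δ P (_∩_ P (Min P I) (Δ P C))

    R : Subset P
    R = _∪_ P (_∖_ P (Inc P C) I) (_∖_ P (Δ P C) D)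

    ceiling⁻ : ∀ {c} → T (C c) →
               T (∇ P I c) × ¬ T (I c) × (∀ {z} → T (∇ P I z) → ¬ T (I z) → z ≼ c → z ≡ c)
    ceiling⁻ Cc =
      let (∇c∖Ic , minimal) = Min⁻ (_∖_ P (∇ P I) I) Cc
          (∇c , ¬Ic) = to T-∧ ∇c∖Ic
      in ∇c , to T-not ¬Ic , λ ∇z ¬Iz → minimal (from T-∧ (∇z , from T-not ¬Iz))

    ceiling-∉ : ∀ {c} → T (C c) → ¬ T (I c)
    ceiling-∉ = proj₁ ∘ proj₂ ∘ ceiling⁻

    ceiling-below : ∀ {i z} → T (I i) → i ≼ z → ¬ T (I z) → ∃ λ c → T (C c) × c ≼ z
    ceiling-below Ii i≼z ¬Iz =
      minimal-below (_∖_ P (∇ P I) I) (from T-∧ (∇⁺ Ii i≼z , from T-not ¬Iz))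

    I-upward-within-Inc : ∀ {i z} → T (I i) → i ≼ z → T (Inc P C z) → T (I z)
    I-upward-within-Inc {z = z} Ii i≼z Inc-z = decidable-stable (T? (I z)) λ ¬Iz →
      let (c , Cc , c≼z) = ceiling-below Ii i≼z ¬Iz in Inc⁻ Inc-z Cc (inj₂ c≼z)

    D⁺ : ∀ {m y} → T (Min P I m) → T (Δ P C m) → y ≼ m → T (D y)
    D⁺ min-m ΔCm y≼m = Δ⁺ (from T-∧ (min-m , ΔCm)) y≼m

    D⁻ : ∀ {y} → T (D y) → ∃ λ m → T (Min P I m) × T (Δ P C m) × y ≼ m
    D⁻ Dy = let (m , min-m∧ΔCm , y≼m) = Δ⁻ Dy
                (min-m , ΔCm) = to T-∧ min-m∧ΔCm
            in m , min-m , ΔCm , y≼m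

    R⁺-Inc : ∀ {y} → T (Inc P C y) → ¬ T (I y) → T (R y)
    R⁺-Inc Inc-y ¬Iy = from T-∨ (inj₁ (from T-∧ (Inc-y , from T-not ¬Iy)))

    R⁺-ΔC : ∀ {y} → T (Δ P C y) → ¬ T (D y) → T (R y)
    R⁺-ΔC ΔCy ¬Dy = from T-∨ (inj₂ (from T-∧ (ΔCy , from T-not ¬Dy)))

    R⁻ : ∀ {y} → T (R y) → (T (Inc P C y) × ¬ T (I y)) ⊎ (T (Δ P C y) × ¬ T (D y))
    R⁻ Ry with to T-∨ Ry
    ... | inj₁ Inc-y∖I = let (Inc-y , ¬Iy) = to T-∧ Inc-y∖I in inj₁ (Inc-y , to T-not ¬Iy)
    ... | inj₂ ΔCy∖D = let (ΔCy , ¬Dy) = to T-∧ ΔCy∖D in inj₂ (ΔCy , to T-not ¬Dy)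

    R-above-I⊆ΔC∖D : ∀ {a b} → T (I a) → a ≼ b → T (R b) → T (Δ P C b) × ¬ T (D b)
    R-above-I⊆ΔC∖D Ia a≼b Rb with R⁻ Rb
    ... | inj₁ (Inc-b , ¬Ib) = ⊥-elim (¬Ib (I-upward-within-Inc Ia a≼b Inc-b))
    ... | inj₂ ΔCb∖D = ΔCb∖D

    R-upward-within-ΔC : ∀ {a z} → T (R a) → a ≼ z → T (Δ P C z) → T (R z)
    R-upward-within-ΔC {z = z} Ra a≼z ΔCz = R⁺-ΔC ΔCz ¬Dz
      where
        ¬Dz : ¬ T (D z)
        ¬Dz Dz with R⁻ Ra
        ... | inj₁ (Inc-a , _) =
          let (c , Cc , z≼c) = Δ⁻ ΔCz in Inc⁻ Inc-a Cc (inj₁ (≼-trans a≼z z≼c))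
        ... | inj₂ (_ , ¬Da) = ¬Da (Δ-downward a≼z Dz)

    module _ (I-ic : IntervalClosed P I) where

      ceiling-∉D : ∀ {c} → T (C c) → ¬ T (D c)
      ceiling-∉D {c} Cc Dc =
        let (m , min-m , _ , c≼m) = D⁻ Dc
            (i , Ii , i≼c) = ∇⁻ (proj₁ (ceiling⁻ Cc))
        in ceiling-∉ Cc (I-ic i m c Ii (proj₁ (Min⁻ I min-m)) i≼c c≼m)

      ceiling⊆R : ∀ {c} → T (C c) → T (R c)
      ceiling⊆R Cc = R⁺-ΔC (Δ⁺ Cc ≼-refl) (ceiling-∉D Cc)

      R-ic : IntervalClosed P R
      R-ic a b z Ra Rb a≼z z≼b with R⁻ Rb
      ... | inj₂ (ΔCb , _) = R-upward-within-ΔC Ra a≼z (Δ-downward z≼b ΔCb)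
      ... | inj₁ (Inc-b , ¬Ib) with T? (Inc P C z)
      ...   | yes Inc-z = R⁺-Inc Inc-z (λ Iz → ¬Ib (I-upward-within-Inc Iz z≼b Inc-b))
      ...   | no ¬Inc-z with ¬Inc⁻ C ¬Inc-z
      ...     | s , Cs , inj₁ z≼s = R-upward-within-ΔC Ra a≼z (Δ⁺ Cs z≼s)
      ...     | s , Cs , inj₂ s≼z = ⊥-elim (Inc⁻ Inc-b Cs (inj₂ (≼-trans s≼z z≼b)))

      I-between-I-and-R : ∀ {a z b} → T (I a) → T (R b) → a ≼ z → z ≼ b → z ≢ b → T (I z)
      I-between-I-and-R {a} {z} {b} Ia Rb a≼z z≼b z≢b with T? (I z) | T? (I b)
      ... | yes Iz | _ = Iz
      ... | no _ | yes Ib = I-ic a b z Ia Ib a≼z z≼b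
      ... | no ¬Iz | no ¬Ib =
        -- z and b both lie in ∇I ∖ I below some c ∈ Min (∇I ∖ I), so both equal c.
        let (ΔCb , _) = R-above-I⊆ΔC∖D Ia (≼-trans a≼z z≼b) Rb
            (c , Cc , b≼c) = Δ⁻ ΔCb
            (_ , _ , minimal) = ceiling⁻ Cc
        in ⊥-elim (z≢b (trans (minimal (∇⁺ Ia a≼z) ¬Iz (≼-trans z≼b b≼c))
                              (sym (minimal (∇⁺ Ia (≼-trans a≼z z≼b)) ¬Ib b≼c))))

      R-between-I-and-R : ∀ {a z b} → T (I a) → T (R b) → a ≼ z → z ≼ b → a ≢ z → T (R z)
      R-between-I-and-R {a} {z} Ia Rb a≼z z≼b a≢z =
        R⁺-ΔC (Δ-downward z≼b (proj₁ (R-above-I⊆ΔC∖D Ia (≼-trans a≼z z≼b) Rb))) ¬Dz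
        where
          ¬Dz : ¬ T (D z)
          ¬Dz Dz = let (m , min-m , _ , z≼m) = D⁻ Dz
                       (Im , minimal) = Min⁻ I min-m
                   in a≢z (trans (minimal Ia (≼-trans a≼z z≼m))
                                 (sym (minimal (I-ic a m z Ia Im a≼z z≼m) z≼m)))

      module _ {U : Subset P} where

        private
          from-R : ∀ {y} → T (U y) → T (piecewise U R I y) → T (R y)
          from-R Uy = subst T (piecewise-in U R I Uy)

          into-R : ∀ {y} → T (U y) → T (R y) → T (piecewise U R I y)
          into-R Uy = subst T (sym (piecewise-in U R I Uy))

          from-I : ∀ {y} → ¬ T (U y) → T (piecewise U R I y) → T (I y)
          from-I ¬Uy = subst T (piecewise-out U R I ¬Uy)

          into-I : ∀ {y} → ¬ T (U y) → T (I y) → T (piecewise U R I y)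
          into-I ¬Uy = subst T (sym (piecewise-out U R I ¬Uy))

        piecewise-ic : UpSet U → IntervalClosed P (piecewise U R I)
        piecewise-ic upward a b z Ka Kb a≼z z≼b = by-cases (T? (U z)) (T? (U a)) (T? (U b))
          where
            by-cases : Dec (T (U z)) → Dec (T (U a)) → Dec (T (U b)) → T (piecewise U R I z)
            by-cases (yes Uz) (yes Ua) _ =
              into-R Uz (R-ic a b z (from-R Ua Ka) (from-R (upward Uz z≼b) Kb) a≼z z≼b)
            by-cases (yes Uz) (no ¬Ua) _ =
              into-R Uz (R-between-I-and-R (from-I ¬Ua Ka) (from-R (upward Uz z≼b) Kb) a≼z z≼b
                           (λ { refl → ¬Ua Uz }))
            by-cases (no ¬Uz) (yes Ua) _ = ⊥-elim (¬Uz (upward Ua a≼z))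
            by-cases (no ¬Uz) (no ¬Ua) (yes Ub) =
              into-I ¬Uz (I-between-I-and-R (from-I ¬Ua Ka) (from-R Ub Kb) a≼z z≼b
                           (λ { refl → ¬Uz Ub }))
            by-cases (no ¬Uz) (no ¬Ua) (no ¬Ub) =
              into-I ¬Uz (I-ic a b z (from-I ¬Ua Ka) (from-I ¬Ub Kb) a≼z z≼b)

        remove-blocked : ∀ {x} → (∀ {y} → y ≼ x → ¬ T (U y)) → (∀ {y} → x ≺ y → T (U y)) →
                         T (I x) → T (R x) → ¬ IntervalClosed P (remove P x (piecewise U R I))
        remove-blocked {x} below-out above-in Ix Rx =
          let (ΔCx , ¬Dx) = R-above-I⊆ΔC∖D Ix ≼-refl Rx
              (m , Im , m≺x) = ¬Min⁻ I Ix (λ min-x → ¬Dx (D⁺ min-x ΔCx ≼-refl))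
              (c , Cc , x≼c) = Δ⁻ ΔCx
              x≢c = λ x≡c → ceiling-∉ Cc (subst (T ∘ I) x≡c Ix)
          in removing-interior-point (into-I (below-out (proj₁ m≺x)) Im)
                                     (into-R (above-in (x≼c , x≢c)) (ceiling⊆R Cc)) m≺x (x≼c , x≢c)

        insert-blocked : ∀ {x} → (∀ {y} → y ≼ x → ¬ T (U y)) → (∀ {y} → x ≺ y → T (U y)) →
                         ¬ T (I x) → ¬ T (R x) → ¬ IntervalClosed P (insert P x (piecewise U R I))
        insert-blocked {x} below-out above-in ¬Ix ¬Rx ic with T? (Δ P C x)
        ... | yes ΔCx =
          let (m , min-m , ΔCm , x≼m) = D⁻ (decidable-stable (T? (D x)) (¬Rx ∘ R⁺-ΔC ΔCx))
              (Im , _) = Min⁻ I min-m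
              (c , Cc , m≼c) = Δ⁻ ΔCm
              x≢m = λ x≡m → ¬Ix (subst (T ∘ I) (sym x≡m) Im)
              x≢c = λ x≡c → x≢m (≼-antisym x≼m (subst (m ≼_) (sym x≡c) m≼c))
              Kc = into-R (above-in (≼-trans x≼m m≼c , x≢c)) (ceiling⊆R Cc)
              Rm = from-R (above-in (x≼m , x≢m)) (insert-ic-above ic Kc (x≼m , x≢m) m≼c)
          in proj₂ (R-above-I⊆ΔC∖D Im ≼-refl Rm) (D⁺ min-m ΔCm ≼-refl)
        ... | no ¬ΔCx with ¬Inc⁻ C (λ Inc-x → ¬Rx (R⁺-Inc Inc-x ¬Ix))
        ...   | s , Cs , inj₁ x≼s = ¬ΔCx (Δ⁺ Cs x≼s)
        ...   | s , Cs , inj₂ s≼x =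
          let (i , Ii , i≼s) = ∇⁻ (proj₁ (ceiling⁻ Cs))
              s≢x = λ s≡x → ¬ΔCx (subst (T ∘ Δ P C) s≡x (Δ⁺ Cs ≼-refl))
              Ks = insert-ic-below ic (into-I (below-out (≼-trans i≼s s≼x)) Ii) i≼s (s≼x , s≢x)
          in ceiling-∉ Cs (from-I (below-out s≼x) Ks)

theorem1p1 : (P : FinPoset) (ext : LinearExtension P) (I : Subset P) →
    IntervalClosed P I →
    ∀ x → Row P ext I x ≡
      _∪_ P (_∖_ P (Inc P (⌈_⌉ P I)) I)
            (_∖_ P (Δ P (⌈_⌉ P I)) (Δ P (_∩_ P (Min P I) (Δ P (⌈_⌉ P I))))) x
theorem1p1 P ext I I-ic =
  Row-≗ P (piecewise-ic P I I-ic) (remove-blocked P I I-ic) (insert-blocked P I I-ic) ext
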